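{- Let $d\in\mathbb{Z}_{\ge1}$ and $\gamma\in\mathbb{Z}_{\ge2}$. If $r(d)=\gamma^i$ for some real $i\notin\mathbb{Z}_{\ge1}$, then the constraint system $\mathcal{S}_{d,\gamma}$ described in the context has no integer solution with this value of $r(d)$. Consequently, in every integer solution of $\mathcal{S}_{d,\gamma}$ one has $r(d)=\gamma^i$ for some positive integer $i$.
   Context: The constraint system $\mathcal{S}_{d,\gamma}$ in the integer variables $x^{\mathrm{bin}}(\ell),y(\ell),z(\ell)$ ($\ell\in\{0,\dots,d-1\}$) and $r(\ell)$ ($\ell\in\{0,\dots,d\}$) consists of, for each $\ell\in\{0,\dots,d-1\}$: $y(\ell)\ge0$; $y(\ell)\le r(\ell+1)/\gamma^{2^\ell}+1/(\gamma^{2^\ell}+1)$; $y(\ell)\ge r(\ell+1)/\gamma^{2^\ell}-(\gamma^{2^\ell}-1)/\gamma^{2^\ell}$; $x^{\mathrm{bin}}(\ell)\ge0$; $x^{\mathrm{bin}}(\ell)\le1$; $x^{\mathrm{bin}}(\ell)\le y(\ell)$; $y(\ell)\le(\gamma^{2^\ell}+1)x^{\mathrm{bin}}(\ell)$; $r(\ell)\ge0$; $(\gamma^{2^\ell}-1)z(\ell)+r(\ell)=r(\ell+1)$; $z(\ell)\ge0$; $z(\ell)\ge-\gamma^{2^\ell}+\gamma^{2^\ell}x^{\mathrm{bin}}(\ell)+r(\ell)$; $z(\ell)\le\gamma^{2^\ell}x^{\mathrm{bin}}(\ell)$; $z(\ell)\le r(\ell)$; together with the three constraints $r(0)=1$,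 $r(d)\ge2$, $r(d)\le\gamma^{2^d-1}$. Every positive integer value $m$ of $r(d)$ can be written as $\gamma^{i}$ with $i=\log m/\log\gamma$. -}

module Defs where

open import Data.Nat as ℕ using (ℕ; suc; _^_; _<_)
open import Data.Integer using (ℤ; +_; _+_; _-_; _*_; _≤_; 0ℤ; 1ℤ)
open import Data.Product using (_×_)
open import Relation.Binary.PropositionalEquality using (_≡_)

G : ℕ → ℕ → ℤ
G γ ℓ = + (γ ^ (2 ^ ℓ))

-- The two constraints with
-- rational coefficients are multiplied through by the positive denominators:
--   y ≤ r(ℓ+1)/g + 1/(g+1)       ⟺  g(g+1)·y ≤ (g+1)·r(ℓ+1) + g
--   y ≥ r(ℓ+1)/g − (g−1)/g       ⟺  g·y ≥ r(ℓ+1) − (g−1)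
LevelConstraints : (γ : ℕ) (ℓ : ℕ) (x y z r : ℕ → ℤ) → Set
LevelConstraints γ ℓ x y z r =
  let g = G γ ℓ in
    (0ℤ ≤ y ℓ)
  × (g * (g + 1ℤ) * y ℓ ≤ (g + 1ℤ) * r (suc ℓ) + g)
  × (r (suc ℓ) - (g - 1ℤ) ≤ g * y ℓ)
  × (0ℤ ≤ x ℓ)
  × (x ℓ ≤ 1ℤ)
  × (x ℓ ≤ y ℓ)
  × (y ℓ ≤ (g + 1ℤ) * x ℓ)
  × (0ℤ ≤ r ℓ)
  × ((g - 1ℤ) * z ℓ + r ℓ ≡ r (suc ℓ))
  × (0ℤ ≤ z ℓ)
  × ((0ℤ - g) + g * x ℓ + r ℓ ≤ z ℓ)
  × (z ℓ ≤ g * x ℓ)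
  × (z ℓ ≤ r ℓ)

-- (x, y, z, r) is an integer solution of S_{d,γ}; x stands for x^bin.
-- Values of the functions outside the index ranges are irrelevant.
Solution : (d γ : ℕ) (x y z r : ℕ → ℤ) → Set
Solution d γ x y z r =
    (∀ ℓ → ℓ < d → LevelConstraints γ ℓ x y z r)
  × (r 0 ≡ 1ℤ)
  × (+ 2 ≤ r d)
  × (r d ≤ + (γ ^ ((2 ^ d) ℕ.∸ 1)))

-- At every level x^bin(ℓ) is 0 or 1, and the constraints on z(ℓ) then force z(ℓ) = 0 or
-- z(ℓ) = r(ℓ) respectively, so r(ℓ+1) = (γ^{2^ℓ} − 1) z(ℓ) + r(ℓ) is either r(ℓ) or
-- γ^{2^ℓ} r(ℓ).  Starting from r(0) = 1, every r(ℓ) is a power of γ, and r(d) ≥ 2 rules out γ^0.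
module Submission where

open import Defs
open import Data.Nat as ℕ using (ℕ; zero; suc; _^_; _≤_; s≤s; z≤n)
import Data.Nat.Properties as ℕₚ
open import Data.Integer using (ℤ; +_; -[1+_]; _+_; _-_; _*_; 0ℤ; 1ℤ; +≤+)
  renaming (_≤_ to _≤ℤ_)
import Data.Integer.Properties as ℤₚ
open import Data.Integer.Tactic.RingSolver using (solve-∀)
open import Data.Product using (_×_; ∃-syntax; _,_)
open import Data.Sum using (_⊎_; inj₁; inj₂)
open import Relation.Binary.PropositionalEquality using (_≡_; refl; sym; trans; cong; subst)
open import Relation.Nullary using (contradiction)

IsPowerOf : ℕ → ℤ → Set
IsPowerOf γ m = ∃[ k ] m ≡ + (γ ^ k)

*-isPowerOf : ∀ {γ a b} → IsPowerOf γ a → IsPowerOf γ b → IsPowerOf γ (a * b)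
*-isPowerOf {γ} (j , refl) (k , refl) =
  j ℕ.+ k , trans (sym (ℤₚ.pos-* (γ ^ j) (γ ^ k))) (cong +_ (sym (ℕₚ.^-distribˡ-+-* γ j k)))

G-isPowerOf : ∀ γ ℓ → IsPowerOf γ (G γ ℓ)
G-isPowerOf γ ℓ = 2 ^ ℓ , refl

0≤x≤1⇒x≡0⊎x≡1 : ∀ {x} → 0ℤ ≤ℤ x → x ≤ℤ 1ℤ → x ≡ 0ℤ ⊎ x ≡ 1ℤ
0≤x≤1⇒x≡0⊎x≡1 {+ 0}           _  _               = inj₁ refl
0≤x≤1⇒x≡0⊎x≡1 {+ 1}           _  _               = inj₂ refl
0≤x≤1⇒x≡0⊎x≡1 {+ suc (suc n)} _  (+≤+ (s≤s ()))
0≤x≤1⇒x≡0⊎x≡1 { -[1+ n ] }    () _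

z≡0⊎z≡r : ∀ g {x z r} → 0ℤ ≤ℤ x → x ≤ℤ 1ℤ → 0ℤ ≤ℤ z →
          (0ℤ - g) + g * x + r ≤ℤ z → z ≤ℤ g * x → z ≤ℤ r → z ≡ 0ℤ ⊎ z ≡ r
z≡0⊎z≡r g {x} {z} {r} 0≤x x≤1 0≤z lower z≤gx z≤r with 0≤x≤1⇒x≡0⊎x≡1 0≤x x≤1
... | inj₁ refl = inj₁ (ℤₚ.≤-antisym (subst (z ≤ℤ_) (ℤₚ.*-zeroʳ g) z≤gx) 0≤z)
... | inj₂ refl = inj₂ (ℤₚ.≤-antisym z≤r (subst (_≤ℤ z) (cancel g r) lower))
  where
  cancel : ∀ g r → (0ℤ - g) + g * 1ℤ + r ≡ r
  cancel = solve-∀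

next≡r⊎next≡g*r : ∀ g {z r r′} → (g - 1ℤ) * z + r ≡ r′ → z ≡ 0ℤ ⊎ z ≡ r → r′ ≡ r ⊎ r′ ≡ g * r
next≡r⊎next≡g*r g {r = r} refl (inj₁ refl) = inj₁ (stay g r)
  where
  stay : ∀ g r → (g - 1ℤ) * 0ℤ + r ≡ r
  stay = solve-∀
next≡r⊎next≡g*r g {r = r} refl (inj₂ refl) = inj₂ (grow g r)
  where
  grow : ∀ g r → (g - 1ℤ) * r + r ≡ g * r
  grow = solve-∀

level-isPowerOf : ∀ d γ x y z r → Solution d γ x y z r → ∀ ℓ → ℓ ≤ d → IsPowerOf γ (r ℓ)
level-isPowerOf d γ x y z r (_ , r0≡1 , _) zero _ = 0 , r0≡1
level-isPowerOf d γ x y z r sol@(levels , _) (suc ℓ) ℓ<d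
  with level-isPowerOf d γ x y z r sol ℓ (ℕₚ.<⇒≤ ℓ<d) | levels ℓ ℓ<d
... | previous | _ , _ , _ , 0≤x , x≤1 , _ , _ , _ , recurrence , 0≤z , lower , z≤gx , z≤r
  with next≡r⊎next≡g*r (G γ ℓ) recurrence (z≡0⊎z≡r (G γ ℓ) 0≤x x≤1 0≤z lower z≤gx z≤r)
... | inj₁ next≡r   = subst (IsPowerOf γ) (sym next≡r) previous
... | inj₂ next≡g*r = subst (IsPowerOf γ) (sym next≡g*r) (*-isPowerOf (G-isPowerOf γ ℓ) previous)

lemma8 : (d γ : ℕ) → 1 ≤ d → 2 ≤ γ →
         (x y z r : ℕ → ℤ) → Solution d γ x y z r →
         ∃[ i ] (1 ≤ i × r d ≡ + (γ ^ i))
lemma8 d γ _ _ x y z r sol@(_ , _ , 2≤rd , _) with level-isPowerOf d γ x y z r sol d ℕₚ.≤-refl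
... | zero  , rd≡1   = contradiction (subst (+ 2 ≤ℤ_) rd≡1 2≤rd) λ { (+≤+ (s≤s ())) }
... | suc k , rd≡γ^k = suc k , s≤s z≤n , rd≡γ^k
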